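{- Let $\mathfrak{M}=(W,R,V)$ be a Kripke model and $\mathfrak{J}^{\mathfrak{M}}=(W',R',V')$ the associated $\mathsf{BFNL^*}$-model. For every $w\in W$ and every modal formula $A$, $\mathfrak{M},w\models A$ if and only if $\mathfrak{J}^{\mathfrak{M}},w_1\models A^\dagger$.
   Context: Modal formulas over a set $P$ of letters: $A::=p\mid\bot\mid A\wedge B\mid A\vee B\mid A\supset B\mid\Diamond A$, with the usual Kripke semantics on $\mathfrak{M}=(W,R,V)$, $R\subseteq W^2$, $V:P\to\wp(W)$ ($w\models\Diamond A$ iff some $u$ with $Rwu$ has $u\models A$). For a distinguished letter $m\notin P$, $(\cdot)^\dagger$ is: $p^\dagger=p$, $\bot^\dagger=\bot$, $(A\wedge B)^\dagger=A^\dagger\wedge B^\dagger$, $(A\vee B)^\dagger=A^\dagger\vee B^\dagger$, $(A\supset B)^\dagger=\neg A^\dagger\vee B^\dagger$, $(\Diamond A)^\dagger=m\cdot A^\dagger$. A $\mathsf{BFNL^*}$-model is $(W,R,V)$ with $R$ ternary; satisfaction: $u\models p$ iff $u\in V(p)$; $\bot$ false, $\top$ true; $\neg,\wedge,\vee$ classical; $u\models A\cdot B$ iff there are $v,w$ with $R(u,v,w)$, $v\models A$, $w\models B$; $u\models A/B$ iff for all $v,w$ with $R(w,u,v)$, $v\models B$ implies $w\models A$; $u\models A\backslash B$ iff for all $v,w$ with $R(v,w,u)$, $w\models A$ implies $v\models B$. The model $\mathfrak{J}^{\mathfrak{M}}$: $W'=\{w_1,w_2\mid w\in W\}$ (two distinct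 copies of each state), $R'=\{(w_1,w_2,u_1)\mid (w,u)\in R\}$, $V'(p)=\{w_1,w_2\mid w\in V(p)\}$ for $p\in P$, and $V'(m)=W'$. -}

module Defs where

open import Data.Product using (Σ; _×_; _,_)
open import Data.Sum using (_⊎_)
open import Data.Empty using (⊥)
open import Data.Unit using (⊤)
open import Relation.Nullary using (¬_)
open import Relation.Binary.PropositionalEquality using (_≡_)

data MFm (P : Set) : Set where
  var  : P → MFm P
  ⊥ₘ   : MFm P
  _∧ₘ_ : MFm P → MFm P → MFm P
  _∨ₘ_ : MFm P → MFm P → MFm P
  _⊃ₘ_ : MFm P → MFm P → MFm P
  ◇_   : MFm P → MFm P

record Kripke (P : Set) : Set₁ where
  field
    W : Set
    R : W → W → Set
    V : P → W → Set

open Kripke public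

_,_⊨_ : {P : Set} (M : Kripke P) → W M → MFm P → Set
M , w ⊨ var p = V M p w
M , w ⊨ ⊥ₘ = ⊥
M , w ⊨ (A ∧ₘ B) = (M , w ⊨ A) × (M , w ⊨ B)
M , w ⊨ (A ∨ₘ B) = (M , w ⊨ A) ⊎ (M , w ⊨ B)
M , w ⊨ (A ⊃ₘ B) = (M , w ⊨ A) → (M , w ⊨ B)
M , w ⊨ (◇ A) = Σ (W M) (λ u → R M w u × (M , u ⊨ A))

data Letter (P : Set) : Set where
  old : P → Letter P
  m   : Letter P

data BFm (Q : Set) : Set where
  var  : Q → BFm Q
  ⊥ᵇ   : BFm Q
  ⊤ᵇ   : BFm Q
  ¬ᵇ_  : BFm Q → BFm Q
  _∧ᵇ_ : BFm Q → BFm Q → BFm Q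
  _∨ᵇ_ : BFm Q → BFm Q → BFm Q
  _·_  : BFm Q → BFm Q → BFm Q
  _/_  : BFm Q → BFm Q → BFm Q
  _∖_  : BFm Q → BFm Q → BFm Q

record BModel (Q : Set) : Set₁ where
  field
    U  : Set
    T  : U → U → U → Set
    VB : Q → U → Set

open BModel public

_,_⊩_ : {Q : Set} (N : BModel Q) → U N → BFm Q → Set
N , u ⊩ var p = VB N p u
N , u ⊩ ⊥ᵇ = ⊥
N , u ⊩ ⊤ᵇ = ⊤
N , u ⊩ (¬ᵇ A) = ¬ (N , u ⊩ A)
N , u ⊩ (A ∧ᵇ B) = (N , u ⊩ A) × (N , u ⊩ B)
N , u ⊩ (A ∨ᵇ B) = (N , u ⊩ A) ⊎ (N , u ⊩ B)
N , u ⊩ (A · B) = Σ (U N) λ v → Σ (U N) λ w → T N u v w × (N , v ⊩ A) × (N , w ⊩ B)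
N , u ⊩ (A / B) = (v w : U N) → T N w u v → N , v ⊩ B → N , w ⊩ A
N , u ⊩ (A ∖ B) = (v w : U N) → T N v w u → N , w ⊩ A → N , v ⊩ B

_† : {P : Set} → MFm P → BFm (Letter P)
var p † = var (old p)
⊥ₘ † = ⊥ᵇ
(A ∧ₘ B) † = (A †) ∧ᵇ (B †)
(A ∨ₘ B) † = (A †) ∨ᵇ (B †)
(A ⊃ₘ B) † = (¬ᵇ (A †)) ∨ᵇ (B †)
(◇ A) † = var m · (A †)

-- two distinct copies of each state
data Copy : Set where
  c₁ c₂ : Copy

data R' {P : Set} (M : Kripke P) : W M × Copy → W M × Copy → W M × Copy → Set where
  mkR' : (w u : W M) → R M w u → R' M (w , c₁) (w , c₂) (u , c₁)

V' : {P : Set} (M : Kripke P) → Letter P → W M × Copy → Set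
V' M (old p) (w , _) = V M p w
V' M m _ = ⊤

J : {P : Set} → Kripke P → BModel (Letter P)
J M = record { U = W M × Copy ; T = R' M ; VB = V' M }

-- Every connective is translated
-- homomorphically except ⊃, whose translation ¬ A† ∨ B† needs excluded middle, and ◇: the only
-- R'-triples out of w₁ are (w₁, w₂, u₁) with R w u, and m holds everywhere, so m · A† at w₁
-- says exactly that A† holds at u₁ for some R-successor u of w.
module Submission where

open import Defs
open import Data.Product using (Σ; _×_; _,_)
open import Data.Product.Function.Dependent.Propositional using (Σ-⇔)
open import Data.Product.Function.NonDependent.Propositional using (_×-⇔_)
open import Data.Sum using (_⊎_; inj₁; inj₂; map₁; swap)
open import Data.Sum.Function.Propositional using (_⊎-⇔_)
open import Data.Unit using (tt)
open import Function.Bundles using (_⇔_; mk⇔; Equivalence)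
open import Function.Construct.Composition using (_⇔-∘_)
open import Function.Construct.Identity using (⇔-id; ↠-id)
open import Function.Related.TypeIsomorphisms using (¬-cong-⇔)
open import Relation.Nullary using (¬_; contradiction)

→⇔¬⊎ : {X Y : Set} → X ⊎ ¬ X → (X → Y) ⇔ (¬ X ⊎ Y)
→⇔¬⊎ {X} {Y} x∨¬x = mk⇔ to from
  where
  to : (X → Y) → ¬ X ⊎ Y
  to f = swap (map₁ f x∨¬x)
  from : ¬ X ⊎ Y → X → Y
  from (inj₁ ¬x) x = contradiction x ¬x
  from (inj₂ y)  _ = y

Σ-cong-⇔ : {I : Set} {A B : I → Set} → (∀ i → A i ⇔ B i) → Σ I A ⇔ Σ I B
Σ-cong-⇔ A⇔B = Σ-⇔ (↠-id _) (A⇔B _)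

J-m·⇔successor : {P : Set} (M : Kripke P) (w : W M) (B : BFm (Letter P)) →
  (Σ (W M) λ u → R M w u × J M , (u , c₁) ⊩ B) ⇔ (J M , (w , c₁) ⊩ (var m · B))
J-m·⇔successor M w B = mk⇔ to from
  where
  to : (Σ (W M) λ u → R M w u × J M , (u , c₁) ⊩ B) → J M , (w , c₁) ⊩ (var m · B)
  to (u , wRu , b) = (w , c₂) , (u , c₁) , mkR' w u wRu , tt , b
  from : J M , (w , c₁) ⊩ (var m · B) → Σ (W M) λ u → R M w u × J M , (u , c₁) ⊩ B
  from (.(w , c₂) , .(u , c₁) , mkR' .w u wRu , _ , b) = u , wRu , b

⊨⇔J⊩† : ((X : Set) → X ⊎ ¬ X) → {P : Set} (M : Kripke P) (w : W M) (A : MFm P) →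
  (M , w ⊨ A) ⇔ (J M , (w , c₁) ⊩ (A †))
⊨⇔J⊩† lem M w (var p)  = ⇔-id _
⊨⇔J⊩† lem M w ⊥ₘ       = ⇔-id _
⊨⇔J⊩† lem M w (A ∧ₘ B) = ⊨⇔J⊩† lem M w A ×-⇔ ⊨⇔J⊩† lem M w B
⊨⇔J⊩† lem M w (A ∨ₘ B) = ⊨⇔J⊩† lem M w A ⊎-⇔ ⊨⇔J⊩† lem M w B
⊨⇔J⊩† lem M w (A ⊃ₘ B) =
  (¬-cong-⇔ (⊨⇔J⊩† lem M w A) ⊎-⇔ ⊨⇔J⊩† lem M w B) ⇔-∘ →⇔¬⊎ (lem _)
⊨⇔J⊩† lem M w (◇ A)    =
  J-m·⇔successor M w (A †) ⇔-∘ Σ-cong-⇔ (λ u → ⇔-id _ ×-⇔ ⊨⇔J⊩† lem M u A)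

lemma1 : ((X : Set) → X ⊎ ¬ X) →
    {P : Set} (M : Kripke P) (w : W M) (A : MFm P) →
    ((M , w ⊨ A) → (J M , (w , c₁) ⊩ (A †))) × ((J M , (w , c₁) ⊩ (A †)) → (M , w ⊨ A))
lemma1 lem M w A = to , from
  where open Equivalence (⊨⇔J⊩† lem M w A)
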